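{- Let $s \geq 2$ and $m_0, m_1, \dots, m_s \geq 2$ be integers, and let $G \in \mathcal{G}_{3}(m_0, m_1, \dots, m_s)$. Then $G$ is $3$-$\gamma_{c}$-critical and satisfies $\alpha(G) \leq \kappa(G) < \delta(G)$.
   Context: A set $D \subseteq V(G)$ is a connected dominating set of $G$ if every vertex of $G$ is in $D$ or adjacent to a vertex of $D$, and $G[D]$ is connected; $\gamma_{c}(G)$ is the minimum size of such a set. For non-adjacent $u,v$, $G+uv$ is $G$ with edge $uv$ added. $G$ is $3$-$\gamma_{c}$-critical if $\gamma_{c}(G)=3$ and $\gamma_{c}(G+uv)<3$ for every pair of non-adjacent vertices $u,v$. $\alpha$ is the independence number, $\kappa$ the connectivity (minimum size of a vertex set whose removal disconnects the graph), $\delta$ the minimum degree. The class $\mathcal{G}_{3}(m_0, \dots, m_s)$: take pairwise disjoint vertex sets $M_0, M_1, \dots, M_s$ with $|M_i| = m_i$ and further vertices $a_1, \dots, a_s$. The graph has vertex set $M_0 \cup \dots \cup M_s \cup \{a_1, \dots, a_s\}$ and exactly the following edges: for $1 \leq i \leq s$, $a_i$ is adjacent to every vertex of $\left(\bigcup_{j=0}^{s} M_j\right) \setminus M_i$; $M_0$ is a clique; $\bigcup_{i=1}^{s} M_i$ is a clique. The class consists of all graphs (up to isomorphism) obtained this way. -}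

module Defs where

open import Data.Nat using (ℕ; zero; suc; _≤_; _<_)
open import Data.Fin using (Fin)
open import Data.Fin.Subset using (Subset; _∈_; _∉_; ∁; ∣_∣)
open import Data.Product using (Σ; ∃; ∃-syntax; _×_; _,_)
open import Data.Sum using (_⊎_)
open import Data.Empty using (⊥)
open import Relation.Nullary using (¬_)
open import Relation.Binary.PropositionalEquality using (_≡_; _≢_)
open import Function.Bundles using (_↔_; _⇔_; Inverse)

-- A graph on the vertex set Fin n, given by its adjacency relation.
-- (Simplicity is not required here; it is inherited from the
-- isomorphism with the construction in the class G₃.)
Graph : ℕ → Set₁
Graph n = Fin n → Fin n → Set

module _ {n : ℕ} (G : Graph n) where

  data Walk (S : Subset n) : Fin n → Fin n → Set where
    here : ∀ {u} → Walk S u u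
    step : ∀ {u v w} → G u v → v ∈ S → Walk S v w → Walk S u w

  InducedConnected : Subset n → Set
  InducedConnected S = ∀ {u v} → u ∈ S → v ∈ S → Walk S u v

  Dominating : Subset n → Set
  Dominating D = ∀ v → v ∈ D ⊎ (∃[ u ] (u ∈ D × G u v))

  ConnectedDominating : Subset n → Set
  ConnectedDominating D = Dominating D × InducedConnected D

  ConnDomNumber : ℕ → Set
  ConnDomNumber k =
    (∃[ D ] (ConnectedDominating D × ∣ D ∣ ≡ k)) ×
    (∀ D → ConnectedDominating D → k ≤ ∣ D ∣)

  Independent : Subset n → Set
  Independent S = ∀ {u v} → u ∈ S → v ∈ S → ¬ G u v

  IndependenceNumber : ℕ → Set
  IndependenceNumber k =
    (∃[ S ] (Independent S × ∣ S ∣ ≡ k)) ×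
    (∀ S → Independent S → ∣ S ∣ ≤ k)

  Disconnecting : Subset n → Set
  Disconnecting S = ∃[ u ] ∃[ v ] (u ∉ S × v ∉ S × ¬ Walk (∁ S) u v)

  Connectivity : ℕ → Set
  Connectivity k =
    (∃[ S ] (Disconnecting S × ∣ S ∣ ≡ k)) ×
    (∀ S → Disconnecting S → k ≤ ∣ S ∣)

  Degree : Fin n → ℕ → Set
  Degree v d = ∃[ N ] ((∀ u → (u ∈ N ⇔ G v u)) × ∣ N ∣ ≡ d)

  MinDegree : ℕ → Set
  MinDegree d = (∃[ v ] Degree v d) × (∀ v e → Degree v e → d ≤ e)

addEdge : ∀ {n} → Graph n → Fin n → Fin n → Graph n
addEdge G u v x y = G x y ⊎ ((x ≡ u × y ≡ v) ⊎ (x ≡ v × y ≡ u))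

Critical3 : ∀ {n} → Graph n → Set
Critical3 {n} G =
  ConnDomNumber G 3 ×
  (∀ (u v : Fin n) → u ≢ v → ¬ G u v →
     ∃[ k ] (k < 3 × ConnDomNumber (addEdge G u v) k))

-- The construction G₃(m₀,…,m_s): m : Fin (suc s) → ℕ gives m₀,…,m_s.
-- Vertices: inj₁ (i , x) is the x-th vertex of M_i; inj₂ j is a_{j+1}.
CVertex : (s : ℕ) → (Fin (suc s) → ℕ) → Set
CVertex s m = (Σ (Fin (suc s)) (λ i → Fin (m i))) ⊎ Fin s

open Data.Sum using (inj₁; inj₂)

CAdj : (s : ℕ) (m : Fin (suc s) → ℕ) → CVertex s m → CVertex s m → Set
CAdj s m (inj₁ (i , x)) (inj₁ (j , y)) =
  ((i , x) ≢ (j , y)) ×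
  ((i ≡ Fin.zero × j ≡ Fin.zero) ⊎ (i ≢ Fin.zero × j ≢ Fin.zero))
CAdj s m (inj₁ (i , x)) (inj₂ j) = i ≢ Fin.suc j
CAdj s m (inj₂ j) (inj₁ (i , x)) = i ≢ Fin.suc j
CAdj s m (inj₂ j) (inj₂ k) = ⊥

InClass : ∀ {n} (s : ℕ) (m : Fin (suc s) → ℕ) → Graph n → Set
InClass {n} s m G =
  Σ (Fin n ↔ CVertex s m) λ f →
    ∀ u v → (G u v ⇔ CAdj s m (Inverse.to f u) (Inverse.to f v))

-- No vertex and no edge of G dominates it (every vertex misses two vertices, and the two ends
-- of an edge always miss a common vertex), while the star a₁ – {M₀-vertex, M₂-vertex} is a
-- connected dominating set, so γ_c(G) = 3. After adding a missing edge uv, a single edge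
-- dominates (uv itself, or M_i – a_j when u = a_i and v = a_j), and no vertex does, so
-- γ_c(G + uv) = 2. The vertices a_j form an independent set of size s separating M₀ from M₁;
-- conversely an independent set lies in s cliques (or in the two cliques M₀ and M₁ ∪ … ∪ M_s if
-- it contains no a_j), and any two non-adjacent vertices are joined by s internally disjoint
-- paths of length at most 3. Hence α = κ = s, while every vertex has at least s + 1 neighbours.

module Submission where

open import Defs
open import Data.Nat using (ℕ; zero; suc; _+_; _≤_; _<_; z≤n; s≤s)
open import Data.Nat.Properties using (≤-refl; ≤-trans; ≤-antisym; ≤-totalOrder)
open import Data.Fin using (Fin; zero; suc; punchOut; fromℕ<; _≟_)
open import Data.Fin.Properties using (punchOut-injective; suc-injective; fromℕ<-injective; any?)
open import Data.Fin.Subset using (Subset; inside; outside; _∈_; _∉_; ∣_∣; _-_; _─_; ∁; Nonempty; Empty)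
open import Data.Fin.Subset.Properties
  using (x∈p⇒∣p-x∣<∣p∣; x∈p∧x≢y⇒x∈p-y; p─q⊆p; x∈⁅x⁆; nonempty?; x∉p⇒x∈∁p; x∈∁p⇒x∉p; p⊆q⇒∣p∣≤∣q∣)
  renaming (_∈?_ to _∈ˢ?_)
open import Data.Vec using ([]; _∷_; here; there)
import Data.Vec as Vec
open import Data.Vec.Properties using (lookup∘tabulate; []=⇒lookup; lookup⇒[]=)
open import Data.List using (List; []; _∷_; length; tabulate; allFin)
import Data.List as List
open import Data.List.Properties using (length-tabulate; length-map)
open import Data.List.Membership.Propositional using (find) renaming (_∈_ to _∈ₗ_)
open import Data.List.Membership.Propositional.Properties using (∈-tabulate⁺; ∈-tabulate⁻; ∈-allFin)
open import Data.List.Relation.Unary.Any as Any using (Any; here; there)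
import Data.List.Relation.Unary.Any.Properties as Any
open import Data.List.Relation.Unary.All as All using (All; []; _∷_)
import Data.List.Relation.Unary.All.Properties as All
open import Data.List.Relation.Unary.AllPairs using ([]; _∷_)
open import Data.List.Relation.Unary.Unique.Propositional using (Unique)
import Data.List.Relation.Unary.Unique.Propositional.Properties as Unique
open import Data.List.Extrema ≤-totalOrder using (argmin; f[argmin]≤f[xs])
open import Data.Bool using (if_then_else_)
open import Data.Bool.Properties using (T-≡)
open import Data.Product using (Σ; ∃₂; ∃-syntax; _×_; _,_; proj₁; proj₂; swap)
import Data.Product as Product
open import Data.Product.Properties using (,-injectiveʳ-UIP)
import Data.Product.Properties as ×
open import Data.Product.Function.NonDependent.Propositional using (_×-⇔_)
open import Data.Sum using (_⊎_; inj₁; inj₂; [_,_]′)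
import Data.Sum as Sum
open import Data.Sum.Properties using (inj₁-injective; inj₂-injective)
import Data.Sum.Properties as ⊎
open import Data.Sum.Function.Propositional using (_⊎-⇔_)
open import Data.Unit using (⊤; tt)
open import Data.Empty using (⊥; ⊥-elim)
open import Function using (_∘_; id; _⇔_; mk⇔; Equivalence; _↔_; Inverse)
import Function.Properties.Equivalence as ⇔
open import Relation.Nullary using (¬_; Dec; yes; no; does; contradiction)
open import Relation.Nullary.Decidable
  using (isYes; toWitness; fromWitness; dec-true; dec-false; _×-dec_; _⊎-dec_; ¬?)
import Relation.Nullary.Decidable as Dec
open import Relation.Unary using (Decidable)
open import Relation.Binary using (DecidableEquality)
open import Relation.Binary.PropositionalEquality
  using (_≡_; _≢_; refl; sym; trans; cong; subst; subst₂)
open import Axiom.UniquenessOfIdentityProofs using (module Decidable⇒UIP)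

private variable
  n k : ℕ
  x y : Fin n
  p : Subset n

x∈p─q⇒x∉q : ∀ {q : Subset n} → x ∈ p ─ q → x ∉ q
x∈p─q⇒x∉q {p = _ ∷ p} {_ ∷ q} (there x∈) (there x∈q) = x∈p─q⇒x∉q x∈ x∈q

x∈p-y⇒x≢y : x ∈ p - y → x ≢ y
x∈p-y⇒x≢y {x = x} x∈ refl = x∈p─q⇒x∉q x∈ (x∈⁅x⁆ x)

x∈p-y⇒x∈p : x ∈ p - y → x ∈ p
x∈p-y⇒x∈p {p = p} = p─q⊆p p _

x∈p⇒x∈p-y⊎x≡y : x ∈ p → x ∈ p - y ⊎ x ≡ y
x∈p⇒x∈p-y⊎x≡y {x = x} {y = y} x∈p with x ≟ y
... | yes x≡y = inj₂ x≡y
... | no  x≢y = inj₁ (x∈p∧x≢y⇒x∈p-y x∈p x≢y)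

Empty[p-x]⇒⊆⁅x⁆ : Empty (p - x) → y ∈ p → y ≡ x
Empty[p-x]⇒⊆⁅x⁆ empty y∈p = [ (λ y∈ → contradiction (_ , y∈) empty) , id ]′ (x∈p⇒x∈p-y⊎x≡y y∈p)

Empty[p-x-y]⇒⊆⁅x,y⁆ : ∀ {z} → Empty (p - x - y) → z ∈ p → z ≡ x ⊎ z ≡ y
Empty[p-x-y]⇒⊆⁅x,y⁆ empty z∈p with x∈p⇒x∈p-y⊎x≡y z∈p
... | inj₁ z∈p-x = inj₂ (Empty[p-x]⇒⊆⁅x⁆ empty z∈p-x)
... | inj₂ z≡x   = inj₁ z≡x

x∈p∧k≤∣p-x∣⇒k<∣p∣ : x ∈ p → k ≤ ∣ p - x ∣ → k < ∣ p ∣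
x∈p∧k≤∣p-x∣⇒k<∣p∣ x∈p k≤ = ≤-trans (s≤s k≤) (x∈p⇒∣p-x∣<∣p∣ x∈p)

-- In the inductive step the values of h on the rest of p avoid h here, so punchOut moves them
-- into Fin k.
∣p∣≤injection : ∀ (p : Subset n) (h : ∀ {x} → x ∈ p → Fin k) →
                (∀ {x y} (x∈p : x ∈ p) (y∈p : y ∈ p) → h x∈p ≡ h y∈p → x ≡ y) → ∣ p ∣ ≤ k
∣p∣≤injection []            h h-inj = z≤n
∣p∣≤injection (outside ∷ p) h h-inj =
  ∣p∣≤injection p (h ∘ there) (λ x∈p y∈p e → suc-injective (h-inj (there x∈p) (there y∈p) e))
∣p∣≤injection {k = zero}  (inside ∷ p) h h-inj with h here
... | ()
∣p∣≤injection {k = suc k} (inside ∷ p) h h-inj = s≤s (∣p∣≤injection p h′ h′-inj)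
  where
  h[here]≢h : ∀ {x} (x∈p : x ∈ p) → h here ≢ h (there x∈p)
  h[here]≢h x∈p e with h-inj here (there x∈p) e
  ... | ()
  h′ : ∀ {x} → x ∈ p → Fin k
  h′ x∈p = punchOut (h[here]≢h x∈p)
  h′-inj : ∀ {x y} (x∈p : x ∈ p) (y∈p : y ∈ p) → h′ x∈p ≡ h′ y∈p → x ≡ y
  h′-inj x∈p y∈p e = suc-injective
    (h-inj (there x∈p) (there y∈p) (punchOut-injective (h[here]≢h x∈p) (h[here]≢h y∈p) e))

∣p∣≤length : ∀ (xs : List (Fin n)) → (∀ {z} → z ∈ p → z ∈ₗ xs) → ∣ p ∣ ≤ length xs
∣p∣≤length {p = p} xs p⊆xs = ∣p∣≤injection p (Any.index ∘ p⊆xs) index-inj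
  where
  index-inj : ∀ {x y} (x∈p : x ∈ p) (y∈p : y ∈ p) →
              Any.index (p⊆xs x∈p) ≡ Any.index (p⊆xs y∈p) → x ≡ y
  index-inj x∈p y∈p e = trans (Any.lookup-index (p⊆xs x∈p))
    (trans (cong (List.lookup xs) e) (sym (Any.lookup-index (p⊆xs y∈p))))

length≤∣p∣ : ∀ {xs : List (Fin n)} → Unique xs → (∀ {z} → z ∈ₗ xs → z ∈ p) → length xs ≤ ∣ p ∣
length≤∣p∣ {xs = []} _ _ = z≤n
length≤∣p∣ {p = p} {xs = x ∷ xs} (x∉xs ∷ xs-unique) xs⊆p =
  x∈p∧k≤∣p-x∣⇒k<∣p∣ (xs⊆p (here refl)) (length≤∣p∣ xs-unique xs⊆p-x)
  where
  xs⊆p-x : ∀ {z} → z ∈ₗ xs → z ∈ p - x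
  xs⊆p-x z∈xs = x∈p∧x≢y⇒x∈p-y (xs⊆p (Any.there z∈xs)) (λ z≡x → All.lookup x∉xs z∈xs (sym z≡x))

∣p∣≡length : ∀ {xs : List (Fin n)} → Unique xs → (∀ {z} → z ∈ p ⇔ z ∈ₗ xs) → ∣ p ∣ ≡ length xs
∣p∣≡length {xs = xs} xs-unique p⇔xs =
  ≤-antisym (∣p∣≤length xs (Equivalence.to p⇔xs)) (length≤∣p∣ xs-unique (Equivalence.from p⇔xs))

injective⇒≤∣p∣ : ∀ (g : Fin k → Fin n) → (∀ {i j} → g i ≡ g j → i ≡ j) → (∀ i → g i ∈ p) → k ≤ ∣ p ∣
injective⇒≤∣p∣ g g-inj g∈p = subst (_≤ _) (length-tabulate g)
  (length≤∣p∣ (Unique.tabulate⁺ g-inj) (λ z∈ → let i , z≡gi = ∈-tabulate⁻ z∈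
                                                in  subst (_∈ _) (sym z≡gi) (g∈p i)))

⟦_⟧ : ∀ {P : Fin n → Set} → Decidable P → Subset n
⟦ P? ⟧ = Vec.tabulate (isYes ∘ P?)

∈⟦⟧ : ∀ {P : Fin n → Set} (P? : Decidable P) {x} → x ∈ ⟦ P? ⟧ ⇔ P x
∈⟦⟧ P? {x} = mk⇔
  (λ x∈ → toWitness {a? = P? x} (Equivalence.from T-≡ (trans (sym lookup-x) ([]=⇒lookup x∈))))
  (λ Px → lookup⇒[]= x _ (trans lookup-x (Equivalence.to T-≡ (fromWitness {a? = P? x} Px))))
  where
  lookup-x : Vec.lookup ⟦ P? ⟧ x ≡ isYes (P? x)
  lookup-x = lookup∘tabulate (isYes ∘ P?) x

fromList : List (Fin n) → Subset n
fromList xs = ⟦ (λ x → Any.any? (x ≟_) xs) ⟧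

module _ {A : Set} (R : A → A → Set) where

  Dominates : A → A → Set
  Dominates x w = w ≡ x ⊎ R x w

  undominated : ∀ {x w} → w ≢ x → ¬ R x w → ¬ Dominates x w
  undominated w≢x ¬Rxw = [ w≢x , ¬Rxw ]′

  NoDominatingVertex : Set
  NoDominatingVertex = ∀ x → ∃[ w ] ¬ Dominates x w

  MissesTwo : Set
  MissesTwo = ∀ x → ∃₂ λ w₁ w₂ → w₁ ≢ w₂ × ¬ Dominates x w₁ × ¬ Dominates x w₂

  NoDominatingEdge : Set
  NoDominatingEdge = ∀ x y → R x y → ∃[ w ] (¬ Dominates x w × ¬ Dominates y w)

  record DominatingStar (k : ℕ) : Set where
    field
      hub        : A
      leaves     : List A
      leaf-count : length leaves ≡ k
      distinct   : Unique (hub ∷ leaves)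
      spokes     : All (λ x → R hub x × R x hub) leaves
      dominating : ∀ w → Any (λ x → Dominates x w) (hub ∷ leaves)

  -- The paths x – near i – far i – y (possibly near i = far i); label shows that paths with
  -- different indices share no inner vertex.
  record DisjointPaths (k : ℕ) (x y : A) : Set where
    field
      near far   : Fin k → A
      label      : A → Fin k
      label-near : ∀ i → label (near i) ≡ i
      label-far  : ∀ i → label (far i) ≡ i
      start      : ∀ i → R x (near i)
      middle     : ∀ i → near i ≡ far i ⊎ R (near i) (far i)
      end        : ∀ i → R (far i) y

  record Neighbours (x : A) (k : ℕ) : Set where
    field
      neighbour : Fin k → A
      label     : A → Fin k
      label-neighbour : ∀ i → label (neighbour i) ≡ i
      adjacent  : ∀ i → R x (neighbour i)

-- addEdge G u v unfolds to AddEdge G u v, so the lemmas about AddEdge apply to it.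
Joins : {A : Set} → A → A → A → A → Set
Joins u v x y = (x ≡ u × y ≡ v) ⊎ (x ≡ v × y ≡ u)

AddEdge : {A : Set} → (A → A → Set) → A → A → A → A → Set
AddEdge R u v x y = R x y ⊎ Joins u v x y

module _ {A : Set} {R : A → A → Set} where

  dominates-addEdge⁺ : ∀ {u v x w} → Dominates R x w → Dominates (AddEdge R u v) x w
  dominates-addEdge⁺ = Sum.map₂ inj₁

  missesTwo⇒noDominatingVertex : MissesTwo R → NoDominatingVertex R
  missesTwo⇒noDominatingVertex misses x = let w , _ , _ , ¬dom , _ = misses x in w , ¬dom

  joins-functional : ∀ {u v x y z : A} → u ≢ v → Joins u v x y → Joins u v x z → y ≡ z
  joins-functional u≢v (inj₁ (_ , y≡v)) (inj₁ (_ , z≡v)) = trans y≡v (sym z≡v)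
  joins-functional u≢v (inj₂ (_ , y≡u)) (inj₂ (_ , z≡u)) = trans y≡u (sym z≡u)
  joins-functional u≢v (inj₁ (x≡u , _)) (inj₂ (x≡v , _)) = contradiction (trans (sym x≡u) x≡v) u≢v
  joins-functional u≢v (inj₂ (x≡v , _)) (inj₁ (x≡u , _)) = contradiction (trans (sym x≡u) x≡v) u≢v

  dominates-addEdge : ∀ {u v x w} → Dominates (AddEdge R u v) x w → Dominates R x w ⊎ Joins u v x w
  dominates-addEdge (inj₁ w≡x)          = inj₁ (inj₁ w≡x)
  dominates-addEdge (inj₂ (inj₁ Rxw))   = inj₁ (inj₂ Rxw)
  dominates-addEdge (inj₂ (inj₂ joins)) = inj₂ joins

  addEdge-noDominatingVertex : DecidableEquality A → ∀ {u v} → u ≢ v →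
                               MissesTwo R → NoDominatingVertex (AddEdge R u v)
  addEdge-noDominatingVertex _≟ₐ_ {u} {v} u≢v misses x with misses x
  ... | w₁ , w₂ , w₁≢w₂ , ¬dom₁ , ¬dom₂ with (x ≟ₐ u ×-dec w₁ ≟ₐ v) ⊎-dec (x ≟ₐ v ×-dec w₁ ≟ₐ u)
  ...   | no ¬joins₁ = w₁ , [ ¬dom₁ , ¬joins₁ ]′ ∘ dominates-addEdge
  ...   | yes joins₁ =
          w₂ , [ ¬dom₂ , (λ joins₂ → w₁≢w₂ (joins-functional u≢v joins₁ joins₂)) ]′ ∘ dominates-addEdge

  addEdge-swap : ∀ {u v x y} → AddEdge R u v x y → AddEdge R v u x y
  addEdge-swap (inj₁ Rxy)          = inj₁ Rxy
  addEdge-swap (inj₂ (inj₁ joins)) = inj₂ (inj₂ joins)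
  addEdge-swap (inj₂ (inj₂ joins)) = inj₂ (inj₁ joins)

  dominatingStar-mono : ∀ {R′ : A → A → Set} {k} → (∀ {x y} → R x y → R′ x y) →
                        DominatingStar R k → DominatingStar R′ k
  dominatingStar-mono R⊆R′ σ = record
    { hub = hub ; leaves = leaves ; leaf-count = leaf-count ; distinct = distinct
    ; spokes     = All.map (Product.map R⊆R′ R⊆R′) spokes
    ; dominating = Any.map (Sum.map₂ R⊆R′) ∘ dominating
    }
    where open DominatingStar σ

  disjointPaths-sym : ∀ {k x y} → (∀ {x y} → R x y → R y x) →
                      DisjointPaths R k x y → DisjointPaths R k y x
  disjointPaths-sym R-sym π = record
    { near = far ; far = near ; label = label ; label-near = label-far ; label-far = label-near
    ; start  = R-sym ∘ end
    ; middle = λ i → Sum.map sym R-sym (middle i)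
    ; end    = R-sym ∘ start
    }
    where open DisjointPaths π

module _ {n : ℕ} (E : Graph n) where

  private variable
    S D : Subset n

  _++ʷ_ : ∀ {x y z} → Walk E S x y → Walk E S y z → Walk E S x z
  here           ++ʷ w′ = w′
  step Exy y∈S w ++ʷ w′ = step Exy y∈S (w ++ʷ w′)

  walk-preserves : ∀ (P : Fin n → Set) → (∀ {x y} → P x → E x y → y ∈ S → P y) →
                   ∀ {x y} → Walk E S x y → P x → P y
  walk-preserves P closed here           Px = Px
  walk-preserves P closed (step Exw w∈S w) Px = walk-preserves P closed w (closed Px Exw w∈S)

  ¬walk⇒≢ : ¬ Walk E S x y → x ≢ y
  ¬walk⇒≢ ¬walk refl = ¬walk here

  ¬walk⇒¬edge : y ∈ S → ¬ Walk E S x y → ¬ E x y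
  ¬walk⇒¬edge y∈S ¬walk Exy = ¬walk (step Exy y∈S here)

  walk-in-pair⇒edge : Walk E D x y → y ≢ x → (∀ {z} → z ∈ D → z ≡ x ⊎ z ≡ y) → E x y
  walk-in-pair⇒edge here y≢x _ = contradiction refl y≢x
  walk-in-pair⇒edge (step Exw w∈D w) y≢x D⊆xy with D⊆xy w∈D
  ... | inj₁ refl = walk-in-pair⇒edge w y≢x D⊆xy
  ... | inj₂ refl = Exw

  dominating-nonempty : Fin n → Dominating E D → Nonempty D
  dominating-nonempty v dom with dom v
  ... | inj₁ v∈D           = v , v∈D
  ... | inj₂ (u , u∈D , _) = u , u∈D

  dominated-by-pair : Dominating E D → (∀ {z} → z ∈ D → z ≡ x ⊎ z ≡ y) →
                      ∀ w → Dominates E x w ⊎ Dominates E y w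
  dominated-by-pair dom D⊆xy w with dom w
  ... | inj₁ w∈D = Sum.map inj₁ inj₁ (D⊆xy w∈D)
  ... | inj₂ (z , z∈D , Ezw) with D⊆xy z∈D
  ...   | inj₁ refl = inj₁ (inj₂ Ezw)
  ...   | inj₂ refl = inj₂ (inj₂ Ezw)

  NoDominatingVertex⇒Nonempty[D-x] : NoDominatingVertex E → Dominating E D → ∀ x → Nonempty (D - x)
  NoDominatingVertex⇒Nonempty[D-x] {D} noDom dom x with nonempty? (D - x)
  ... | yes nonempty = nonempty
  ... | no  empty    =
        let w , ¬dom = noDom x
        in  ⊥-elim ([ ¬dom , ¬dom ]′ (dominated-by-pair {y = x} dom (inj₁ ∘ Empty[p-x]⇒⊆⁅x⁆ empty) w))

  NoDominatingEdge⇒Nonempty[D-x-y] : NoDominatingEdge E → ConnectedDominating E D →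
                                     x ∈ D → y ∈ D - x → Nonempty (D - x - y)
  NoDominatingEdge⇒Nonempty[D-x-y] {D} {x} {y} noDom (dom , connected) x∈D y∈D-x
    with nonempty? (D - x - y)
  ... | yes nonempty = nonempty
  ... | no  empty    =
        let D⊆xy : ∀ {z} → z ∈ D → z ≡ x ⊎ z ≡ y
            D⊆xy = Empty[p-x-y]⇒⊆⁅x,y⁆ empty
            Exy  = walk-in-pair⇒edge (connected x∈D (x∈p-y⇒x∈p y∈D-x)) (x∈p-y⇒x≢y y∈D-x) D⊆xy
            w , ¬dom-x , ¬dom-y = noDom x y Exy
        in  ⊥-elim ([ ¬dom-x , ¬dom-y ]′ (dominated-by-pair dom D⊆xy w))

  2≤∣dominating∣ : Fin n → NoDominatingVertex E → Dominating E D → 2 ≤ ∣ D ∣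
  2≤∣dominating∣ v noDom dom =
    let x , x∈D   = dominating-nonempty v dom
        y , y∈D-x = NoDominatingVertex⇒Nonempty[D-x] noDom dom x
    in  x∈p∧k≤∣p-x∣⇒k<∣p∣ x∈D (x∈p∧k≤∣p-x∣⇒k<∣p∣ y∈D-x z≤n)

  3≤∣connectedDominating∣ : Fin n → NoDominatingVertex E → NoDominatingEdge E →
                            ConnectedDominating E D → 3 ≤ ∣ D ∣
  3≤∣connectedDominating∣ v noDomV noDomE cd@(dom , _) =
    let x , x∈D     = dominating-nonempty v dom
        y , y∈D-x   = NoDominatingVertex⇒Nonempty[D-x] noDomV dom x
        z , z∈D-x-y = NoDominatingEdge⇒Nonempty[D-x-y] noDomE cd x∈D y∈D-x
    in  x∈p∧k≤∣p-x∣⇒k<∣p∣ x∈D (x∈p∧k≤∣p-x∣⇒k<∣p∣ y∈D-x (x∈p∧k≤∣p-x∣⇒k<∣p∣ z∈D-x-y z≤n))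

  dominatingStar⇒connectedDominating : DominatingStar E k →
                                       ∃[ D′ ] (ConnectedDominating E D′ × ∣ D′ ∣ ≡ suc k)
  dominatingStar⇒connectedDominating {k} σ = D′ , (dominating , connected) , size
    where
    open DominatingStar σ renaming (dominating to star-dominating)
    D′ : Subset n
    D′ = fromList (hub ∷ leaves)
    D′⇔star : ∀ {z} → z ∈ D′ ⇔ z ∈ₗ hub ∷ leaves
    D′⇔star = ∈⟦⟧ _
    hub∈D′ : hub ∈ D′
    hub∈D′ = Equivalence.from D′⇔star (here refl)
    dominating : Dominating E D′
    dominating w with find (star-dominating w)
    ... | x , x∈star , inj₁ refl = inj₁ (Equivalence.from D′⇔star x∈star)
    ... | x , x∈star , inj₂ Exw  = inj₂ (x , Equivalence.from D′⇔star x∈star , Exw)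
    to-hub : ∀ {z} → z ∈ D′ → Walk E D′ z hub
    to-hub z∈D′ with Equivalence.to D′⇔star z∈D′
    ... | here refl     = here
    ... | there z∈leaf = step (proj₂ (All.lookup spokes z∈leaf)) hub∈D′ here
    from-hub : ∀ {z} → z ∈ D′ → Walk E D′ hub z
    from-hub z∈D′ with Equivalence.to D′⇔star z∈D′
    ... | here refl     = here
    ... | there z∈leaf = step (proj₁ (All.lookup spokes z∈leaf)) z∈D′ here
    connected : InducedConnected E D′
    connected x∈D′ y∈D′ = to-hub x∈D′ ++ʷ from-hub y∈D′
    size : ∣ D′ ∣ ≡ suc k
    size = trans (∣p∣≡length distinct D′⇔star) (cong suc leaf-count)

  disjointPaths⇒≤∣separator∣ : ∀ {u v} → DisjointPaths E k u v → v ∉ S → ¬ Walk E (∁ S) u v → k ≤ ∣ S ∣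
  disjointPaths⇒≤∣separator∣ {k} {S} {v = v} π v∉S ¬walk =
    injective⇒≤∣p∣ (proj₁ ∘ hit) hit-injective (proj₁ ∘ proj₂ ∘ hit)
    where
    open DisjointPaths π
    hit : ∀ i → Σ (Fin n) λ z → z ∈ S × label z ≡ i
    hit i with near i ∈ˢ? S
    ... | yes near∈S = near i , near∈S , label-near i
    ... | no  near∉S with far i ∈ˢ? S
    ...   | yes far∈S = far i , far∈S , label-far i
    ...   | no  far∉S = ⊥-elim (¬walk (step (start i) (x∉p⇒x∈∁p near∉S) (onwards (middle i))))
      where
      onwards : near i ≡ far i ⊎ E (near i) (far i) → Walk E (∁ S) (near i) v
      onwards (inj₁ near≡far) = step (subst (λ z → E z v) (sym near≡far) (end i)) (x∉p⇒x∈∁p v∉S) here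
      onwards (inj₂ Enf) = step Enf (x∉p⇒x∈∁p far∉S) (step (end i) (x∉p⇒x∈∁p v∉S) here)
    hit-injective : ∀ {i j} → proj₁ (hit i) ≡ proj₁ (hit j) → i ≡ j
    hit-injective {i} {j} e =
      trans (sym (proj₂ (proj₂ (hit i)))) (trans (cong label e) (proj₂ (proj₂ (hit j))))

  ∣independent∣≤cover : Independent E S → (cover : Fin n → Fin k) →
                        (∀ {x y} → x ∈ S → y ∈ S → x ≢ y → cover x ≡ cover y → E x y) → ∣ S ∣ ≤ k
  ∣independent∣≤cover {S} independent cover clique = ∣p∣≤injection S (λ {x} _ → cover x) injective
    where
    injective : ∀ {x y} → x ∈ S → y ∈ S → cover x ≡ cover y → x ≡ y
    injective {x} {y} x∈S y∈S e with x ≟ y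
    ... | yes x≡y = x≡y
    ... | no  x≢y = contradiction (clique x∈S y∈S x≢y e) (independent x∈S y∈S)

  module _ (E? : ∀ x y → Dec (E x y)) where

    nbhd : Fin n → Subset n
    nbhd x = ⟦ E? x ⟧

    degree : ∀ x → Degree E x ∣ nbhd x ∣
    degree x = nbhd x , (λ _ → ∈⟦⟧ (E? x)) , refl

    ∣nbhd∣≤degree : ∀ {x d} → Degree E x d → ∣ nbhd x ∣ ≤ d
    ∣nbhd∣≤degree {x} (N , N⇔E , refl) =
      p⊆q⇒∣p∣≤∣q∣ (λ {y} y∈ → Equivalence.from (N⇔E y) (Equivalence.to (∈⟦⟧ (E? x)) y∈))

    minDegree : Fin n → ∃[ v ] MinDegree E ∣ nbhd v ∣
    minDegree v₀ =
      v , (v , degree v) , λ w d deg → ≤-trans (All.lookup v-minimal (∈-allFin w)) (∣nbhd∣≤degree deg)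
      where
      v : Fin n
      v = argmin (∣_∣ ∘ nbhd) v₀ (allFin n)
      v-minimal : All (λ w → ∣ nbhd v ∣ ≤ ∣ nbhd w ∣) (allFin n)
      v-minimal = f[argmin]≤f[xs] v₀ (allFin n)

    neighbours⇒≤∣nbhd∣ : ∀ {x} → Neighbours E x k → k ≤ ∣ nbhd x ∣
    neighbours⇒≤∣nbhd∣ {x = x} ν = injective⇒≤∣p∣ neighbour
      (λ {i} {j} e → trans (sym (label-neighbour i)) (trans (cong label e) (label-neighbour j)))
      (λ i → Equivalence.from (∈⟦⟧ (E? x)) (adjacent i))
      where open Neighbours ν

module Transport {A B : Set} {R : A → A → Set} {S : B → B → Set}
                 (f : A ↔ B) (R⇔S : ∀ x y → R x y ⇔ S (Inverse.to f x) (Inverse.to f y)) where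

  open Inverse f using (to; from) renaming (strictlyInverseˡ to to-from; strictlyInverseʳ to from-to)

  to-injective : ∀ {x y} → to x ≡ to y → x ≡ y
  to-injective {x} {y} e = trans (sym (from-to x)) (trans (cong from e) (from-to y))

  from-injective : ∀ {b c} → from b ≡ from c → b ≡ c
  from-injective {b} {c} e = trans (sym (to-from b)) (trans (cong to e) (to-from c))

  R⇒S : ∀ {x y} → R x y → S (to x) (to y)
  R⇒S {x} {y} = Equivalence.to (R⇔S x y)

  S⇒R : ∀ {x y} → S (to x) (to y) → R x y
  S⇒R {x} {y} = Equivalence.from (R⇔S x y)

  S⇒R-from : ∀ {b c} → S b c → R (from b) (from c)
  S⇒R-from {b} {c} Sbc = S⇒R (subst₂ S (sym (to-from b)) (sym (to-from c)) Sbc)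

  S⇒R-fromʳ : ∀ {x c} → S (to x) c → R x (from c)
  S⇒R-fromʳ {x} Sxc = subst (λ z → R z _) (from-to x) (S⇒R-from Sxc)

  S⇒R-fromˡ : ∀ {b y} → S b (to y) → R (from b) y
  S⇒R-fromˡ {y = y} Sby = subst (R _) (from-to y) (S⇒R-from Sby)

  decidable : (∀ b c → Dec (S b c)) → ∀ x y → Dec (R x y)
  decidable S? x y = Dec.map (⇔.sym (R⇔S x y)) (S? (to x) (to y))

  ¬dominates : ∀ {x w} → ¬ Dominates S (to x) w → ¬ Dominates R x (from w)
  ¬dominates {x} {w} ¬dom (inj₁ w≡x) = ¬dom (inj₁ (trans (sym (to-from w)) (cong to w≡x)))
  ¬dominates {x} {w} ¬dom (inj₂ Rxw) = ¬dom (inj₂ (subst (S (to x)) (to-from w) (R⇒S Rxw)))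

  dominates : ∀ {b c} → Dominates S b c → Dominates R (from b) (from c)
  dominates (inj₁ c≡b) = inj₁ (cong from c≡b)
  dominates (inj₂ Sbc) = inj₂ (S⇒R-from Sbc)

  missesTwo : MissesTwo S → MissesTwo R
  missesTwo misses x =
    let w₁ , w₂ , w₁≢w₂ , ¬dom₁ , ¬dom₂ = misses (to x)
    in  from w₁ , from w₂ , w₁≢w₂ ∘ from-injective , ¬dominates ¬dom₁ , ¬dominates ¬dom₂

  noDominatingEdge : NoDominatingEdge S → NoDominatingEdge R
  noDominatingEdge noDom x y Rxy =
    let w , ¬dom-x , ¬dom-y = noDom (to x) (to y) (R⇒S Rxy)
    in  from w , ¬dominates ¬dom-x , ¬dominates ¬dom-y

  dominatingStar : ∀ {k} → DominatingStar S k → DominatingStar R k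
  dominatingStar σ = record
    { hub        = from hub
    ; leaves     = List.map from leaves
    ; leaf-count = trans (length-map from leaves) leaf-count
    ; distinct   = Unique.map⁺ from-injective distinct
    ; spokes     = All.map⁺ (All.map (Product.map S⇒R-from S⇒R-from) spokes)
    ; dominating = λ w → Any.map⁺ (Any.map (subst (Dominates R _) (from-to w) ∘ dominates)
                                           (dominating (to w)))
    }
    where open DominatingStar σ

  disjointPaths : ∀ {k x y} → DisjointPaths S k (to x) (to y) → DisjointPaths R k x y
  disjointPaths π = record
    { near       = from ∘ near
    ; far        = from ∘ far
    ; label      = label ∘ to
    ; label-near = λ i → trans (cong label (to-from (near i))) (label-near i)
    ; label-far  = λ i → trans (cong label (to-from (far i))) (label-far i)
    ; start      = S⇒R-fromʳ ∘ start
    ; middle     = Sum.map (cong from) S⇒R-from ∘ middle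
    ; end        = S⇒R-fromˡ ∘ end
    }
    where open DisjointPaths π

  neighbours : ∀ {x k} → Neighbours S (to x) k → Neighbours R x k
  neighbours ν = record
    { neighbour       = from ∘ neighbour
    ; label           = label ∘ to
    ; label-neighbour = λ i → trans (cong label (to-from (neighbour i))) (label-neighbour i)
    ; adjacent        = S⇒R-fromʳ ∘ adjacent
    }
    where open Neighbours ν

  addEdge-iso : ∀ u v x y → AddEdge R u v x y ⇔ AddEdge S (to u) (to v) (to x) (to y)
  addEdge-iso u v x y = R⇔S x y ⊎-⇔ ((≡-to ×-⇔ ≡-to) ⊎-⇔ (≡-to ×-⇔ ≡-to))
    where
    ≡-to : ∀ {z w} → z ≡ w ⇔ to z ≡ to w
    ≡-to = mk⇔ (cong to) to-injective

module Construction {t : ℕ} (m : Fin (3 + t) → ℕ) (m≥2 : ∀ i → 2 ≤ m i) where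

  s : ℕ
  s = 2 + t

  V : Set
  V = CVertex s m

  infix 4 _~_ _~?_ _≟ᵥ_
  _~_ : V → V → Set
  _~_ = CAdj s m

  -- M k x lies in M_{k+1} and a j is a_{j+1}, so a j is non-adjacent exactly to the M j x.
  pattern M₀ x  = inj₁ (zero , x)
  pattern M k x = inj₁ (suc k , x)
  pattern a j   = inj₂ j

  first second : ∀ i → Fin (m i)
  first  i = fromℕ< (≤-trans (s≤s z≤n) (m≥2 i))
  second i = fromℕ< (m≥2 i)

  first≢second : ∀ {i} → first i ≢ second i
  first≢second e with fromℕ<-injective 0 1 _ _ e
  ... | ()

  ifFirst : ∀ {B : Set} {i} → Fin (m i) → B → B → B
  ifFirst {i = i} x p q = if does (x ≟ first i) then p else q

  ifFirst-first : ∀ {B : Set} {i} (p q : B) → ifFirst (first i) p q ≡ p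
  ifFirst-first {i = i} p q = cong (if_then p else q) (dec-true (first i ≟ first i) refl)

  ifFirst-second : ∀ {B : Set} {i} (p q : B) → ifFirst (second i) p q ≡ q
  ifFirst-second {i = i} p q =
    cong (if_then p else q) (dec-false (second i ≟ first i) (first≢second ∘ sym))

  twin : ∀ {i} → Fin (m i) → Fin (m i)
  twin {i} x = ifFirst x (second i) (first i)

  twin-≢ : ∀ {i} (x : Fin (m i)) → twin x ≢ x
  twin-≢ {i} x with x ≟ first i
  ... | yes x≡first = λ second≡x → first≢second (trans (sym x≡first) (sym second≡x))
  ... | no  x≢first = x≢first ∘ sym

  another : Fin s → Fin s
  another zero    = suc zero
  another (suc _) = zero

  another-≢ : ∀ k → another k ≢ k
  another-≢ zero    ()
  another-≢ (suc _) ()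

  _≟ᵥ_ : DecidableEquality V
  _≟ᵥ_ = ⊎.≡-dec (×.≡-dec _≟_ _≟_) _≟_

  M-injective : ∀ {i x y} → _≡_ {A = V} (inj₁ (i , x)) (inj₁ (i , y)) → x ≡ y
  M-injective = ,-injectiveʳ-UIP (Decidable⇒UIP.≡-irrelevant _≟_) ∘ inj₁-injective

  class : V → Fin (3 + t)
  class (inj₁ (i , _)) = i
  class (a _)          = zero

  M-class-≢ : ∀ {k l x y} → k ≢ l → M k x ≢ M l y
  M-class-≢ k≢l = k≢l ∘ suc-injective ∘ cong class

  ~-sym : ∀ {p q} → p ~ q → q ~ p
  ~-sym {inj₁ _} {inj₁ _} (p≢q , same-side) = p≢q ∘ sym , Sum.map swap swap same-side
  ~-sym {inj₁ _} {inj₂ _} p~q = p~q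
  ~-sym {inj₂ _} {inj₁ _} p~q = p~q

  _~?_ : ∀ p q → Dec (p ~ q)
  inj₁ (i , x) ~? inj₁ (j , y) = ¬? (×.≡-dec _≟_ _≟_ (i , x) (j , y)) ×-dec
    ((i ≟ zero ×-dec j ≟ zero) ⊎-dec (¬? (i ≟ zero) ×-dec ¬? (j ≟ zero)))
  inj₁ (i , _) ~? a j = ¬? (i ≟ suc j)
  a j ~? inj₁ (i , _) = ¬? (i ≟ suc j)
  a _ ~? a _ = no λ ()

  M₀~M₀ : ∀ {x y} → M₀ x ≢ M₀ y → M₀ x ~ M₀ y
  M₀~M₀ x≢y = x≢y ∘ cong (inj₁ {B = Fin s}) , inj₁ (refl , refl)

  M~M : ∀ {k l x y} → M k x ≢ M l y → M k x ~ M l y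
  M~M x≢y = x≢y ∘ cong (inj₁ {B = Fin s}) , inj₂ ((λ ()) , (λ ()))

  M₀≁M : ∀ {x k y} → ¬ M₀ x ~ M k y
  M₀≁M (_ , inj₂ (0≢0 , _)) = 0≢0 refl

  M≁M₀ : ∀ {k x y} → ¬ M k x ~ M₀ y
  M≁M₀ (_ , inj₂ (_ , 0≢0)) = 0≢0 refl

  a~M : ∀ {j k} x → k ≢ j → a j ~ M k x
  a~M _ k≢j = k≢j ∘ suc-injective

  M~a : ∀ {j k} x → k ≢ j → M k x ~ a j
  M~a _ k≢j = k≢j ∘ suc-injective

  a≁M : ∀ {j} x → ¬ a j ~ M j x
  a≁M _ j≢j = j≢j refl

  M≁a : ∀ {j} x → ¬ M j x ~ a j
  M≁a _ j≢j = j≢j refl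

  missesTwo : MissesTwo _~_
  missesTwo (M₀ x) = M zero (first _) , M zero (second _) , first≢second ∘ M-injective ,
                     undominated _~_ (λ ()) M₀≁M , undominated _~_ (λ ()) M₀≁M
  missesTwo (M k x) = M₀ (first _) , M₀ (second _) , first≢second ∘ M-injective ,
                      undominated _~_ (λ ()) M≁M₀ , undominated _~_ (λ ()) M≁M₀
  missesTwo (a j) = M j (first _) , M j (second _) , first≢second ∘ M-injective ,
                    undominated _~_ (λ ()) (a≁M (first _)) , undominated _~_ (λ ()) (a≁M (second _))

  noDominatingEdge : NoDominatingEdge _~_
  noDominatingEdge (M₀ x) (M₀ y) _ =
    M zero (first _) , undominated _~_ (λ ()) M₀≁M , undominated _~_ (λ ()) M₀≁M
  noDominatingEdge (M k x) (M l y) _ =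
    M₀ (first _) , undominated _~_ (λ ()) M≁M₀ , undominated _~_ (λ ()) M≁M₀
  noDominatingEdge (M₀ x) (a j) _ =
    M j (first _) , undominated _~_ (λ ()) M₀≁M , undominated _~_ (λ ()) (a≁M (first _))
  noDominatingEdge (a j) (M₀ x) _ =
    M j (first _) , undominated _~_ (λ ()) (a≁M (first _)) , undominated _~_ (λ ()) M₀≁M
  noDominatingEdge (M k x) (a j) adj =
    a k , undominated _~_ (λ ()) (M≁a x) , undominated _~_ (adj ∘ cong suc ∘ inj₂-injective) (λ ())
  noDominatingEdge (a j) (M k x) adj =
    a k , undominated _~_ (adj ∘ cong suc ∘ inj₂-injective) (λ ()) , undominated _~_ (λ ()) (M≁a x)
  noDominatingEdge (M₀ x) (M k y) adj = contradiction adj M₀≁M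
  noDominatingEdge (M k x) (M₀ y) adj = contradiction adj M≁M₀

  dominates-M₀ : ∀ x y → Dominates _~_ (M₀ x) (M₀ y)
  dominates-M₀ x y with M₀ y ≟ᵥ M₀ x
  ... | yes y≡x = inj₁ y≡x
  ... | no  y≢x = inj₂ (M₀~M₀ (y≢x ∘ sym))

  dominates-M : ∀ k x l y → Dominates _~_ (M k x) (M l y)
  dominates-M k x l y with M l y ≟ᵥ M k x
  ... | yes y≡x = inj₁ y≡x
  ... | no  y≢x = inj₂ (M~M (y≢x ∘ sym))

  star : DominatingStar _~_ 2
  star = record
    { hub        = a zero
    ; leaves     = M₀ (first _) ∷ M (suc zero) (first _) ∷ []
    ; leaf-count = refl
    ; distinct   = ((λ ()) ∷ (λ ()) ∷ []) ∷ ((λ ()) ∷ []) ∷ [] ∷ []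
    ; spokes     = ((λ ()) , (λ ())) ∷ ((λ ()) , (λ ())) ∷ []
    ; dominating = dominating
    }
    where
    dominating : ∀ w → Any (λ x → Dominates _~_ x w)
                           (a zero ∷ M₀ (first _) ∷ M (suc zero) (first _) ∷ [])
    dominating (M₀ x)        = here (inj₂ (λ ()))
    dominating (M zero x)    = there (there (here (dominates-M _ _ _ _)))
    dominating (M (suc k) x) = here (inj₂ (λ ()))
    dominating (a j)         = there (here (inj₂ (λ ())))

  M₀-M-star : ∀ x k y → DominatingStar (AddEdge _~_ (M₀ x) (M k y)) 1
  M₀-M-star x k y = record
    { hub = M₀ x ; leaves = M k y ∷ [] ; leaf-count = refl
    ; distinct   = ((λ ()) ∷ []) ∷ [] ∷ []
    ; spokes     = (inj₂ (inj₁ (refl , refl)) , inj₂ (inj₂ (refl , refl))) ∷ []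
    ; dominating = dominating
    }
    where
    dominating : ∀ w → Any (λ z → Dominates (AddEdge _~_ (M₀ x) (M k y)) z w) (M₀ x ∷ M k y ∷ [])
    dominating (M₀ z)  = here (dominates-addEdge⁺ {R = _~_} (dominates-M₀ x z))
    dominating (M l z) = there (here (dominates-addEdge⁺ {R = _~_} (dominates-M k y l z)))
    dominating (a j)   = here (inj₂ (inj₁ (λ ())))

  a-M-star : ∀ k y → DominatingStar (AddEdge _~_ (a k) (M k y)) 1
  a-M-star k y = record
    { hub = a k ; leaves = M k y ∷ [] ; leaf-count = refl
    ; distinct   = ((λ ()) ∷ []) ∷ [] ∷ []
    ; spokes     = (inj₂ (inj₁ (refl , refl)) , inj₂ (inj₂ (refl , refl))) ∷ []
    ; dominating = dominating
    }
    where
    dominating : ∀ w → Any (λ z → Dominates (AddEdge _~_ (a k) (M k y)) z w) (a k ∷ M k y ∷ [])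
    dominating (M₀ z)  = here (inj₂ (inj₁ (λ ())))
    dominating (M l z) = there (here (dominates-addEdge⁺ {R = _~_} (dominates-M k y l z)))
    dominating (a j) with j ≟ k
    ... | yes refl = here (inj₁ refl)
    ... | no  j≢k  = there (here (inj₂ (inj₁ (M~a y (j≢k ∘ sym)))))

  a-a-star : ∀ {i j} → i ≢ j → DominatingStar (AddEdge _~_ (a i) (a j)) 1
  a-a-star {i} {j} i≢j = record
    { hub = M i (first _) ; leaves = a j ∷ [] ; leaf-count = refl
    ; distinct   = ((λ ()) ∷ []) ∷ [] ∷ []
    ; spokes     = (inj₁ (M~a (first _) i≢j) , inj₁ (a~M (first _) i≢j)) ∷ []
    ; dominating = dominating
    }
    where
    dominating : ∀ w → Any (λ z → Dominates (AddEdge _~_ (a i) (a j)) z w) (M i (first _) ∷ a j ∷ [])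
    dominating (M₀ z)  = there (here (inj₂ (inj₁ (λ ()))))
    dominating (M l z) = here (dominates-addEdge⁺ {R = _~_} (dominates-M i (first _) l z))
    dominating (a l) with l ≟ j | l ≟ i
    ... | yes refl | _        = there (here (inj₁ refl))
    ... | no _     | yes refl = there (here (inj₂ (inj₂ (inj₂ (refl , refl)))))
    ... | no _     | no l≢i   = here (inj₂ (inj₁ (M~a (first _) (l≢i ∘ sym))))

  dominatingStar-addEdge : ∀ u v → u ≢ v → ¬ u ~ v → DominatingStar (AddEdge _~_ u v) 1
  dominatingStar-addEdge (M₀ x)  (M₀ y)  u≢v u≁v = contradiction (M₀~M₀ u≢v) u≁v
  dominatingStar-addEdge (M k x) (M l y) u≢v u≁v = contradiction (M~M u≢v) u≁v
  dominatingStar-addEdge (M₀ x)  (a j)   _   u≁v = contradiction (λ ()) u≁v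
  dominatingStar-addEdge (a j)   (M₀ x)  _   u≁v = contradiction (λ ()) u≁v
  dominatingStar-addEdge (M₀ x)  (M k y) _   _   = M₀-M-star x k y
  dominatingStar-addEdge (M k y) (M₀ x)  _   _   = dominatingStar-mono (addEdge-swap {R = _~_}) (M₀-M-star x k y)
  dominatingStar-addEdge (a j)   (M k y) _   u≁v with k ≟ j
  ... | yes refl = a-M-star k y
  ... | no  k≢j  = contradiction (a~M y k≢j) u≁v
  dominatingStar-addEdge (M k y) (a j)   _   u≁v with k ≟ j
  ... | yes refl = dominatingStar-mono (addEdge-swap {R = _~_}) (a-M-star k y)
  ... | no  k≢j  = contradiction (M~a y k≢j) u≁v
  dominatingStar-addEdge (a i)   (a j)   u≢v _   = a-a-star (u≢v ∘ cong inj₂)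

  M₀-M-paths : ∀ x k y → DisjointPaths _~_ s (M₀ x) (M k y)
  M₀-M-paths x k y = record
    { near = λ i → a i ; far = λ i → far′ i (i ≟ k) ; label = label
    ; label-near = λ _ → refl
    ; label-far  = λ i → label-far′ i (i ≟ k)
    ; start      = λ _ → λ ()
    ; middle     = λ i → middle′ i (i ≟ k)
    ; end        = λ i → end′ i (i ≟ k)
    }
    where
    far′ : ∀ i → Dec (i ≡ k) → V
    far′ i (yes _) = M (another k) (first _)
    far′ i (no _)  = a i
    label : V → Fin s
    label (inj₁ _) = k
    label (a i)    = i
    label-far′ : ∀ i d → label (far′ i d) ≡ i
    label-far′ i (yes i≡k) = sym i≡k
    label-far′ i (no _)    = refl
    middle′ : ∀ i d → a i ≡ far′ i d ⊎ a i ~ far′ i d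
    middle′ i (yes refl) = inj₂ (a~M (first _) (another-≢ i))
    middle′ i (no _)     = inj₁ refl
    end′ : ∀ i d → far′ i d ~ M k y
    end′ i (yes _)   = M~M (M-class-≢ (another-≢ k))
    end′ i (no i≢k)  = a~M y (i≢k ∘ sym)

  a-a-paths : ∀ i₀ j₀ → DisjointPaths _~_ s (a i₀) (a j₀)
  a-a-paths i₀ j₀ = record
    { near = via ; far = via ; label = label
    ; label-near = label-via ; label-far = label-via
    ; start      = λ i → start′ i (i ≟ i₀) (i ≟ j₀)
    ; middle     = λ _ → inj₁ refl
    ; end        = λ i → end′ i (i ≟ i₀) (i ≟ j₀)
    }
    where
    via′ : ∀ i → Dec (i ≡ i₀) → Dec (i ≡ j₀) → V
    via′ i (yes _) _       = M₀ (first _)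
    via′ i (no _)  (yes _) = M₀ (second _)
    via′ i (no _)  (no _)  = M i (first _)
    via : Fin s → V
    via i = via′ i (i ≟ i₀) (i ≟ j₀)
    label : V → Fin s
    label (M₀ z)  = ifFirst z i₀ j₀
    label (M l _) = l
    label (a _)   = i₀
    label-via′ : ∀ i d d′ → label (via′ i d d′) ≡ i
    label-via′ i (yes i≡i₀) _          = trans (ifFirst-first _ _) (sym i≡i₀)
    label-via′ i (no _)     (yes i≡j₀) = trans (ifFirst-second _ _) (sym i≡j₀)
    label-via′ i (no _)     (no _)     = refl
    label-via : ∀ i → label (via i) ≡ i
    label-via i = label-via′ i (i ≟ i₀) (i ≟ j₀)
    start′ : ∀ i d d′ → a i₀ ~ via′ i d d′
    start′ i (yes _)   _       = λ ()
    start′ i (no _)    (yes _) = λ ()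
    start′ i (no i≢i₀) (no _)  = a~M (first _) i≢i₀
    end′ : ∀ i d d′ → via′ i d d′ ~ a j₀
    end′ i (yes _) _          = λ ()
    end′ i (no _)  (yes _)    = λ ()
    end′ i (no _)  (no i≢j₀)  = M~a (first _) i≢j₀

  a-M-paths : ∀ k y → DisjointPaths _~_ s (a k) (M k y)
  a-M-paths k y = record
    { near = via ; far = via ; label = label
    ; label-near = label-via ; label-far = label-via
    ; start      = λ i → start′ i (i ≟ k)
    ; middle     = λ _ → inj₁ refl
    ; end        = λ i → end′ i (i ≟ k)
    }
    where
    via′ : ∀ i → Dec (i ≡ k) → V
    via′ i (yes _) = M (another k) (second _)
    via′ i (no _)  = M i (first _)
    via : Fin s → V
    via i = via′ i (i ≟ k)
    label : V → Fin s
    label (M₀ _)  = k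
    label (M l z) = ifFirst z l k
    label (a _)   = k
    label-via′ : ∀ i d → label (via′ i d) ≡ i
    label-via′ i (yes i≡k) = trans (ifFirst-second _ _) (sym i≡k)
    label-via′ i (no _)    = ifFirst-first _ _
    label-via : ∀ i → label (via i) ≡ i
    label-via i = label-via′ i (i ≟ k)
    start′ : ∀ i d → a k ~ via′ i d
    start′ i (yes _)   = a~M (second _) (another-≢ k)
    start′ i (no i≢k)  = a~M (first _) i≢k
    end′ : ∀ i d → via′ i d ~ M k y
    end′ i (yes _)   = M~M (M-class-≢ (another-≢ k))
    end′ i (no i≢k)  = M~M (M-class-≢ i≢k)

  disjointPaths : ∀ u v → u ≢ v → ¬ u ~ v → DisjointPaths _~_ s u v
  disjointPaths (M₀ x)  (M₀ y)  u≢v u≁v = contradiction (M₀~M₀ u≢v) u≁v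
  disjointPaths (M k x) (M l y) u≢v u≁v = contradiction (M~M u≢v) u≁v
  disjointPaths (M₀ x)  (a j)   _   u≁v = contradiction (λ ()) u≁v
  disjointPaths (a j)   (M₀ x)  _   u≁v = contradiction (λ ()) u≁v
  disjointPaths (M₀ x)  (M k y) _   _   = M₀-M-paths x k y
  disjointPaths (M k y) (M₀ x)  _   _   = disjointPaths-sym ~-sym (M₀-M-paths x k y)
  disjointPaths (a j)   (M k y) _   u≁v with k ≟ j
  ... | yes refl = a-M-paths k y
  ... | no  k≢j  = contradiction (a~M y k≢j) u≁v
  disjointPaths (M k y) (a j)   _   u≁v with k ≟ j
  ... | yes refl = disjointPaths-sym ~-sym (a-M-paths k y)
  ... | no  k≢j  = contradiction (M~a y k≢j) u≁v
  disjointPaths (a i)   (a j)   _   _   = a-a-paths i j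

  neighbours : ∀ p → Neighbours _~_ p (suc s)
  neighbours (M₀ x) = record
    { neighbour       = λ { zero → M₀ (twin x) ; (suc i) → a i }
    ; label           = λ { (inj₁ _) → zero ; (a i) → suc i }
    ; label-neighbour = λ { zero → refl ; (suc i) → refl }
    ; adjacent        = λ { zero → M₀~M₀ (twin-≢ x ∘ sym ∘ M-injective) ; (suc i) → λ () }
    }
  neighbours (M k x) = record
    { neighbour       = λ { zero → M k (twin x) ; (suc i) → other i (i ≟ k) }
    ; label           = label
    ; label-neighbour = λ { zero → cong (if_then zero else suc k) (dec-true (k ≟ k) refl)
                          ; (suc i) → label-other i (i ≟ k) }
    ; adjacent        = λ { zero → M~M (twin-≢ x ∘ sym ∘ M-injective)
                          ; (suc i) → adjacent-other i (i ≟ k) }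
    }
    where
    other : ∀ i → Dec (i ≡ k) → V
    other i (yes _) = M (another k) (first _)
    other i (no _)  = a i
    label : V → Fin (suc s)
    label (M₀ _)  = zero
    label (M l _) = if does (l ≟ k) then zero else suc k
    label (a i)   = suc i
    label-other : ∀ i d → label (other i d) ≡ suc i
    label-other i (yes i≡k) =
      trans (cong (if_then zero else suc k) (dec-false (another k ≟ k) (another-≢ k)))
            (cong suc (sym i≡k))
    label-other i (no _) = refl
    adjacent-other : ∀ i d → M k x ~ other i d
    adjacent-other i (yes _)   = M~M (M-class-≢ (another-≢ k ∘ sym))
    adjacent-other i (no i≢k)  = M~a x (i≢k ∘ sym)
  neighbours (a j) = record
    { neighbour       = λ { zero → M₀ (first _) ; (suc i) → other i (i ≟ j) }
    ; label           = label
    ; label-neighbour = λ { zero → ifFirst-first _ _ ; (suc i) → label-other i (i ≟ j) }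
    ; adjacent        = λ { zero → λ () ; (suc i) → adjacent-other i (i ≟ j) }
    }
    where
    other : ∀ i → Dec (i ≡ j) → V
    other i (yes _) = M₀ (second _)
    other i (no _)  = M i (first _)
    label : V → Fin (suc s)
    label (M₀ z)  = ifFirst z zero (suc j)
    label (M l _) = suc l
    label (a _)   = zero
    label-other : ∀ i d → label (other i d) ≡ suc i
    label-other i (yes i≡j) = trans (ifFirst-second _ _) (cong suc (sym i≡j))
    label-other i (no _)    = refl
    adjacent-other : ∀ i d → a j ~ other i d
    adjacent-other i (yes _)   = λ ()
    adjacent-other i (no i≢j)  = a~M (first _) i≢j

  IsA : V → Set
  IsA p = ∃[ j ] p ≡ a j

  IsA? : ∀ p → Dec (IsA p)
  IsA? (inj₁ _) = no λ ()
  IsA? (a j)    = yes (j , refl)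

  InM₀ : V → Set
  InM₀ (M₀ _)  = ⊤
  InM₀ (M _ _) = ⊥
  InM₀ (a _)   = ⊥

  a≁a : ∀ {p q} → IsA p → IsA q → ¬ p ~ q
  a≁a (_ , refl) (_ , refl) ()

  M₀~a : ∀ {p q} → InM₀ p → IsA q → p ~ q
  M₀~a {M₀ _} _ (_ , refl) = λ ()

  M₀-closed : ∀ {p q} → InM₀ p → p ~ q → ¬ IsA q → InM₀ q
  M₀-closed {M₀ _} {M₀ _}  _ _     _   = tt
  M₀-closed {M₀ _} {M _ _} _ adj   _   = M₀≁M adj
  M₀-closed {M₀ _} {a j}   _ _     ¬IsA = ¬IsA (j , refl)

  cover₁ : V → Fin s
  cover₁ (M₀ _)  = zero
  cover₁ (M k _) = another k
  cover₁ (a j)   = j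

  cover₁-clique : ∀ {p q} → p ≢ q → ¬ InM₀ p → ¬ InM₀ q → cover₁ p ≡ cover₁ q → p ~ q
  cover₁-clique {M₀ _}  {_}     _   ¬M₀ _   _ = ⊥-elim (¬M₀ tt)
  cover₁-clique {_}     {M₀ _}  _   _   ¬M₀ _ = ⊥-elim (¬M₀ tt)
  cover₁-clique {M _ _} {M _ _} p≢q _   _   _ = M~M p≢q
  cover₁-clique {M k x} {a j}   _   _   _   e = M~a x (λ k≡j → another-≢ k (trans e (sym k≡j)))
  cover₁-clique {a j}   {M k x} _   _   _   e = a~M x (λ k≡j → another-≢ k (trans (sym e) (sym k≡j)))
  cover₁-clique {a _}   {a _}   p≢q _   _   e = ⊥-elim (p≢q (cong inj₂ e))

  cover₂ : V → Fin 2
  cover₂ (M₀ _)   = zero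
  cover₂ (M _ _)  = suc zero
  cover₂ (a _)    = suc zero

  cover₂-clique : ∀ {p q} → p ≢ q → ¬ IsA p → ¬ IsA q → cover₂ p ≡ cover₂ q → p ~ q
  cover₂-clique {M₀ _}  {M₀ _}  p≢q _ _ _ = M₀~M₀ p≢q
  cover₂-clique {M _ _} {M _ _} p≢q _ _ _ = M~M p≢q
  cover₂-clique {M₀ _}  {M _ _} _ _ _ ()
  cover₂-clique {M _ _} {M₀ _}  _ _ _ ()
  cover₂-clique {a j}   {_}     _ ¬IsA _ _ = ⊥-elim (¬IsA (j , refl))
  cover₂-clique {inj₁ _} {a j}  _ _ ¬IsA _ = ⊥-elim (¬IsA (j , refl))

module Properties {t n : ℕ} (m : Fin (3 + t) → ℕ) (m≥2 : ∀ i → 2 ≤ m i) (G : Graph n)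
                  (f : Fin n ↔ CVertex (2 + t) m)
                  (G⇔~ : ∀ x y → G x y ⇔ CAdj (2 + t) m (Inverse.to f x) (Inverse.to f y)) where

  open Construction m m≥2
  open Inverse f using (to; from) renaming (strictlyInverseˡ to to-from; strictlyInverseʳ to from-to)
  module T = Transport {S = _~_} f G⇔~

  some-vertex : Fin n
  some-vertex = from (a zero)

  connDomNumber : ConnDomNumber G 3
  connDomNumber =
    dominatingStar⇒connectedDominating G (T.dominatingStar star) ,
    λ _ → 3≤∣connectedDominating∣ G some-vertex (missesTwo⇒noDominatingVertex (T.missesTwo missesTwo))
                                           (T.noDominatingEdge noDominatingEdge)

  critical : ∀ u v → u ≢ v → ¬ G u v → ∃[ k ] (k < 3 × ConnDomNumber (addEdge G u v) k)
  critical u v u≢v ¬Guv =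
    2 , ≤-refl , dominatingStar⇒connectedDominating (addEdge G u v) star⁺ ,
    λ _ (dom , _) → 2≤∣dominating∣ (addEdge G u v) some-vertex noDom dom
    where
    star⁺ : DominatingStar (addEdge G u v) 1
    star⁺ = Transport.dominatingStar f (T.addEdge-iso u v)
              (dominatingStar-addEdge (to u) (to v) (u≢v ∘ T.to-injective) (¬Guv ∘ T.S⇒R))
    noDom : NoDominatingVertex (addEdge G u v)
    noDom = addEdge-noDominatingVertex _≟_ u≢v (T.missesTwo missesTwo)

  a-vertices : Subset n
  a-vertices = ⟦ IsA? ∘ to ⟧

  from-a : Fin s → Fin n
  from-a j = from (a j)

  ∣a-vertices∣ : ∣ a-vertices ∣ ≡ s
  ∣a-vertices∣ =
    trans (∣p∣≡length (Unique.tabulate⁺ {f = from-a} (inj₂-injective ∘ T.from-injective)) a-vertices⇔list)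
          (length-tabulate from-a)
    where
    a-vertices⇔list : ∀ {z} → z ∈ a-vertices ⇔ z ∈ₗ tabulate from-a
    a-vertices⇔list {z} = mk⇔
      (λ z∈A → let j , toz≡aj = Equivalence.to (∈⟦⟧ (IsA? ∘ to)) z∈A
               in  subst (_∈ₗ _) (trans (sym (cong from toz≡aj)) (from-to z)) (∈-tabulate⁺ {f = from-a} j))
      (λ z∈list → let j , z≡from-aj = ∈-tabulate⁻ {f = from-a} z∈list
                  in  Equivalence.from (∈⟦⟧ (IsA? ∘ to)) (j , trans (cong to z≡from-aj) (to-from _)))

  a-vertices-independent : Independent G a-vertices
  a-vertices-independent x∈A y∈A Gxy = a≁a (∈A x∈A) (∈A y∈A) (T.R⇒S Gxy)
    where
    ∈A : ∀ {x} → x ∈ a-vertices → IsA (to x)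
    ∈A = Equivalence.to (∈⟦⟧ (IsA? ∘ to))

  a-vertices-disconnecting : Disconnecting G a-vertices
  a-vertices-disconnecting = from (M₀ (first _)) , from (M zero (first _)) , ∉A (λ ()) , ∉A (λ ()) , ¬walk
    where
    ∉A : ∀ {p} → ¬ IsA p → from p ∉ a-vertices
    ∉A ¬IsA p∈A = ¬IsA (subst IsA (to-from _) (Equivalence.to (∈⟦⟧ (IsA? ∘ to)) p∈A))
    closed : ∀ {x y} → InM₀ (to x) → G x y → y ∈ ∁ a-vertices → InM₀ (to y)
    closed inM₀ Gxy y∈∁A =
      M₀-closed inM₀ (T.R⇒S Gxy) (x∈∁p⇒x∉p y∈∁A ∘ Equivalence.from (∈⟦⟧ (IsA? ∘ to)))
    ¬walk : ¬ Walk G (∁ a-vertices) (from (M₀ (first _))) (from (M zero (first _)))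
    ¬walk w =
      subst InM₀ (to-from _) (walk-preserves G (InM₀ ∘ to) closed w (subst InM₀ (sym (to-from _)) tt))

  -- If S contains some a_j it avoids M₀, and outside M₀ the fibres of cover₁ are cliques.
  independent≤s : ∀ S → Independent G S → ∣ S ∣ ≤ s
  independent≤s S independent with any? (λ x → x ∈ˢ? S ×-dec IsA? (to x))
  ... | yes (x₀ , x₀∈S , x₀∈A) = ∣independent∣≤cover G independent (cover₁ ∘ to) clique
    where
    ∉M₀ : ∀ {x} → x ∈ S → ¬ InM₀ (to x)
    ∉M₀ x∈S inM₀ = independent x∈S x₀∈S (T.S⇒R (M₀~a inM₀ x₀∈A))
    clique : ∀ {x y} → x ∈ S → y ∈ S → x ≢ y → cover₁ (to x) ≡ cover₁ (to y) → G x y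
    clique x∈S y∈S x≢y e = T.S⇒R (cover₁-clique (x≢y ∘ T.to-injective) (∉M₀ x∈S) (∉M₀ y∈S) e)
  ... | no  no-A = ≤-trans (∣independent∣≤cover G independent (cover₂ ∘ to) clique) (s≤s (s≤s z≤n))
    where
    ∉A : ∀ {x} → x ∈ S → ¬ IsA (to x)
    ∉A x∈S isA = no-A (_ , x∈S , isA)
    clique : ∀ {x y} → x ∈ S → y ∈ S → x ≢ y → cover₂ (to x) ≡ cover₂ (to y) → G x y
    clique x∈S y∈S x≢y e = T.S⇒R (cover₂-clique (x≢y ∘ T.to-injective) (∉A x∈S) (∉A y∈S) e)

  independenceNumber : IndependenceNumber G s
  independenceNumber = (a-vertices , a-vertices-independent , ∣a-vertices∣) , independent≤s

  separator≥s : ∀ S → Disconnecting G S → s ≤ ∣ S ∣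
  separator≥s S (u , v , _ , v∉S , ¬walk) =
    disjointPaths⇒≤∣separator∣ G (T.disjointPaths (disjointPaths (to u) (to v) u≢v u≁v)) v∉S ¬walk
    where
    u≢v : to u ≢ to v
    u≢v = ¬walk⇒≢ G ¬walk ∘ T.to-injective
    u≁v : ¬ to u ~ to v
    u≁v = ¬walk⇒¬edge G (x∉p⇒x∈∁p v∉S) ¬walk ∘ T.S⇒R

  connectivity : Connectivity G s
  connectivity = (a-vertices , a-vertices-disconnecting , ∣a-vertices∣) , separator≥s

  G? : ∀ x y → Dec (G x y)
  G? = T.decidable _~?_

  δ-vertex : Fin n
  δ-vertex = proj₁ (minDegree G G? some-vertex)

  δ : ℕ
  δ = ∣ nbhd G G? δ-vertex ∣

  minDegree-δ : MinDegree G δ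
  minDegree-δ = proj₂ (minDegree G G? some-vertex)

  s<δ : s < δ
  s<δ = neighbours⇒≤∣nbhd∣ G G? (T.neighbours (neighbours (to δ-vertex)))

lemma3p9 : (s : ℕ) (m : Fin (suc s) → ℕ) → 2 ≤ s → (∀ i → 2 ≤ m i) →
           (n : ℕ) (G : Graph n) → InClass s m G →
           Critical3 G ×
           (∃[ a ] ∃[ k ] ∃[ d ]
             (IndependenceNumber G a × Connectivity G k × MinDegree G d ×
              a ≤ k × k < d))
lemma3p9 (suc (suc t)) m (s≤s (s≤s z≤n)) m≥2 n G (f , G⇔~) =
  (connDomNumber , critical) , s , s , δ , independenceNumber , connectivity , minDegree-δ , ≤-refl , s<δ
  where
  open Construction m m≥2 using (s)
  open Properties m m≥2 G f G⇔~
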